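{- Let $\Sigma_\bullet$ be the explicit higher $\lambda$-conversion tower and let $\mathscr{R}_\bullet(\mathscr{G}_\lambda)$ be the recursive completion of the reflexive $6$-cell extension of the low-dimensional $\lambda$-coherence core $\mathscr{G}_\lambda$ (both as described in the context). Then: (i) for every $n\in\mathbb{N}$ there is a map $\mathrm{realize}_n:\mathscr{R}_n(\mathscr{G}_\lambda)\to\Sigma_n$; (ii) these maps commute strictly with source and target: for every $(n+1)$-cell $x$ of $\mathscr{R}_\bullet(\mathscr{G}_\lambda)$, $s(\mathrm{realize}_{n+1}(x))=\mathrm{realize}_n(s x)$ and $t(\mathrm{realize}_{n+1}(x))=\mathrm{realize}_n(t x)$; (iii) hence $\Sigma_\bullet$ carries a strict boundary-preserving realization of $\mathscr{R}_\bullet(\mathscr{G}_\lambda)$ extending the low-dimensional core (i.e. $\mathrm{realize}_n$ is the identity identification for $n\le 3$).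
   Context: Untyped $\lambda$-terms are written with de Bruijn indices: $M,N::=\mathtt{var}\,n\mid M\,N\mid \lambda M$. A reduction sequence from $M$ to $N$ is a finite zigzag $M=M_0\leftrightarrow M_1\leftrightarrow\cdots\leftrightarrow M_k=N$ of $\beta$-steps, $\eta$-steps and their formal inverses; $\mathrm{RedSeq}(M,N)$ is the type of these. $\mathrm{Homotopy}_2(p,q)$ ($p,q\in\mathrm{RedSeq}(M,N)$) is the inductive type of explicit 2-cells generated by reflexivity, symmetry, transitivity, left/right whiskering, horizontal composition, associators and unitors; $\mathrm{Homotopy}_3(\alpha,\beta)$ (for parallel 2-cells) is the analogous inductive type of explicit 3-cells, including pentagon, triangle and interchange generators. For a type $X$ and $x,y\in X$, $\mathrm{HigherDeriv}_X(x,y)$ is the inductive type generated by $\mathsf{refl}_x:\mathrm{HigherDeriv}_X(x,x)$, $\mathsf{symm}:\mathrm{HigherDeriv}_X(x,y)\to\mathrm{HigherDeriv}_X(y,x)$ and $\mathsf{trans}:\mathrm{HigherDeriv}_X(x,y)\to\mathrm{HigherDeriv}_X(y,z)\to\mathrm{HigherDeriv}_X(x,z)$; for a map $f:X\to Y$, $\mathrm{HigherDeriv}(f):\mathrm{HigherDeriv}_X(x,y)\to\mathrm{HigherDeriv}_Y(f x,f y)$ is defined by recursion on constructors. The explicit tower $\Sigma_\bullet$ is the globular set with $\Sigma_0=$ terms, $\Sigma_1=$ reduction sequences, $\Sigma_2=$ explicit 2-cells, $\Sigma_3=$ explicit 3-cells (each packed with its source and target), and for $n\ge 4$ an $n$-cell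 is a triple $(x,y,h)$ with $x,y$ parallel $(n-1)$-cells and $h\in\mathrm{HigherDeriv}(x,y)$, with source $x$ and target $y$. The low-dimensional core $\mathscr{G}_\lambda$ has objects terms, 1-cells $\mathrm{RedSeq}$, 2-cells $\mathrm{Homotopy}_2$, 3-cells $\mathrm{Homotopy}_3$; its reflexive $6$-cell extension adds, in dimensions $4,5,6$, cells $\mathrm{HigherDeriv}(\eta,\theta)$ between parallel cells of the previous dimension (no other generators). The recursive completion $\mathscr{R}_\bullet(\mathscr{G}_\lambda)$ keeps dimensions $0$–$6$ of this extension, and for $n\ge 6$ an $(n+1)$-cell is a triple $(x,y,h)$ with $x,y\in\mathscr{R}_n$ and $h\in\mathrm{HigherDeriv}(x,y)$, with source $x$ and target $y$. -}

module Defs where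

open import Data.Nat using (ℕ; zero; suc; _+_)
open import Data.Product using (Σ; Σ-syntax; _×_; _,_)
open import Relation.Binary.PropositionalEquality using (_≡_)

data Term : Set where
  var : ℕ → Term
  app : Term → Term → Term
  lam : Term → Term

shiftVar : ℕ → ℕ → ℕ
shiftVar zero    n       = suc n
shiftVar (suc c) zero    = zero
shiftVar (suc c) (suc n) = suc (shiftVar c n)

shift : ℕ → Term → Term
shift c (var n)   = var (shiftVar c n)
shift c (app M N) = app (shift c M) (shift c N)
shift c (lam M)   = lam (shift (suc c) M)

-- substVar k n N : the result of substituting N for index k in var n
-- (under k binders), decrementing indices above k.
substVar : ℕ → ℕ → Term → Term
substVar zero    zero    N = N
substVar zero    (suc n) N = var n
substVar (suc k) zero    N = var zero
substVar (suc k) (suc n) N = shift zero (substVar k n N)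

subst : ℕ → Term → Term → Term
subst k N (var n)   = substVar k n N
subst k N (app M P) = app (subst k N M) (subst k N P)
subst k N (lam M)   = lam (subst (suc k) N M)

data Step : Term → Term → Set where
  beta : (M N : Term) → Step (app (lam M) N) (subst zero N M)
  eta  : (M : Term) → Step (lam (app (shift zero M) (var zero))) M
  appL : {M M' : Term} (N : Term) → Step M M' → Step (app M N) (app M' N)
  appR : (M : Term) {N N' : Term} → Step N N' → Step (app M N) (app M N')
  lamξ : {M M' : Term} → Step M M' → Step (lam M) (lam M')

data RedSeq : Term → Term → Set where
  nil : {M : Term} → RedSeq M M
  fwd : {M M₁ N : Term} → Step M M₁ → RedSeq M₁ N → RedSeq M N
  bwd : {M M₁ N : Term} → Step M₁ M → RedSeq M₁ N → RedSeq M N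

infixr 5 _⊙_
_⊙_ : {L M N : Term} → RedSeq L M → RedSeq M N → RedSeq L N
nil     ⊙ q = q
fwd s p ⊙ q = fwd s (p ⊙ q)
bwd s p ⊙ q = bwd s (p ⊙ q)

data Homotopy2 : {M N : Term} → RedSeq M N → RedSeq M N → Set where
  refl2    : {M N : Term} {p : RedSeq M N} → Homotopy2 p p
  symm2    : {M N : Term} {p q : RedSeq M N} → Homotopy2 p q → Homotopy2 q p
  trans2   : {M N : Term} {p q r : RedSeq M N} →
             Homotopy2 p q → Homotopy2 q r → Homotopy2 p r
  whiskerL : {L M N : Term} (r : RedSeq L M) {p q : RedSeq M N} →
             Homotopy2 p q → Homotopy2 (r ⊙ p) (r ⊙ q)
  whiskerR : {L M N : Term} {p q : RedSeq L M} →
             Homotopy2 p q → (r : RedSeq M N) → Homotopy2 (p ⊙ r) (q ⊙ r)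
  hcomp    : {L M N : Term} {p q : RedSeq L M} {r s : RedSeq M N} →
             Homotopy2 p q → Homotopy2 r s → Homotopy2 (p ⊙ r) (q ⊙ s)
  assoc    : {K L M N : Term} (p : RedSeq K L) (q : RedSeq L M) (r : RedSeq M N) →
             Homotopy2 ((p ⊙ q) ⊙ r) (p ⊙ (q ⊙ r))
  lunit    : {M N : Term} (p : RedSeq M N) → Homotopy2 (nil ⊙ p) p
  runit    : {M N : Term} (p : RedSeq M N) → Homotopy2 (p ⊙ nil) p

data Homotopy3 : {M N : Term} {p q : RedSeq M N} →
                 Homotopy2 p q → Homotopy2 p q → Set where
  refl3  : {M N : Term} {p q : RedSeq M N} {α : Homotopy2 p q} → Homotopy3 α α
  symm3  : {M N : Term} {p q : RedSeq M N} {α β : Homotopy2 p q} →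
           Homotopy3 α β → Homotopy3 β α
  trans3 : {M N : Term} {p q : RedSeq M N} {α β γ : Homotopy2 p q} →
           Homotopy3 α β → Homotopy3 β γ → Homotopy3 α γ
  whiskerL3 : {M N : Term} {o p q : RedSeq M N} (γ : Homotopy2 o p)
              {α β : Homotopy2 p q} →
              Homotopy3 α β → Homotopy3 (trans2 γ α) (trans2 γ β)
  whiskerR3 : {M N : Term} {p q r : RedSeq M N} {α β : Homotopy2 p q} →
              Homotopy3 α β → (γ : Homotopy2 q r) →
              Homotopy3 (trans2 α γ) (trans2 β γ)
  whiskerL3₁ : {L M N : Term} (r : RedSeq L M) {p q : RedSeq M N}
               {α β : Homotopy2 p q} →
               Homotopy3 α β → Homotopy3 (whiskerL r α) (whiskerL r β)
  whiskerR3₁ : {L M N : Term} {p q : RedSeq L M} {α β : Homotopy2 p q} →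
               Homotopy3 α β → (r : RedSeq M N) →
               Homotopy3 (whiskerR α r) (whiskerR β r)
  hcomp3 : {L M N : Term} {p q : RedSeq L M} {r s : RedSeq M N}
           {α α' : Homotopy2 p q} {β β' : Homotopy2 r s} →
           Homotopy3 α α' → Homotopy3 β β' → Homotopy3 (hcomp α β) (hcomp α' β')
  assoc3 : {M N : Term} {p q r s : RedSeq M N}
           (α : Homotopy2 p q) (β : Homotopy2 q r) (γ : Homotopy2 r s) →
           Homotopy3 (trans2 (trans2 α β) γ) (trans2 α (trans2 β γ))
  lunit3 : {M N : Term} {p q : RedSeq M N} (α : Homotopy2 p q) →
           Homotopy3 (trans2 refl2 α) α
  runit3 : {M N : Term} {p q : RedSeq M N} (α : Homotopy2 p q) →
           Homotopy3 (trans2 α refl2) α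
  pentagon : {K L M N P : Term} (p : RedSeq K L) (q : RedSeq L M)
             (r : RedSeq M N) (s : RedSeq N P) →
             Homotopy3
               (trans2 (whiskerR (assoc p q r) s)
                       (trans2 (assoc p (q ⊙ r) s) (whiskerL p (assoc q r s))))
               (trans2 (assoc (p ⊙ q) r s) (assoc p q (r ⊙ s)))
  triangle : {L M N : Term} (p : RedSeq L M) (q : RedSeq M N) →
             Homotopy3
               (trans2 (assoc p nil q) (whiskerL p (lunit q)))
               (whiskerR (runit p) q)
  interchange : {L M N : Term} {p q r : RedSeq L M} {u v w : RedSeq M N}
                (α : Homotopy2 p q) (β : Homotopy2 q r)
                (γ : Homotopy2 u v) (δ : Homotopy2 v w) →
                Homotopy3 (hcomp (trans2 α β) (trans2 γ δ))
                          (trans2 (hcomp α γ) (hcomp β δ))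

data HigherDeriv {X : Set} : X → X → Set where
  refl  : {x : X} → HigherDeriv x x
  symm  : {x y : X} → HigherDeriv x y → HigherDeriv y x
  trans : {x y z : X} → HigherDeriv x y → HigherDeriv y z → HigherDeriv x z

HigherDeriv-map : {X Y : Set} (f : X → Y) {x y : X} →
                  HigherDeriv x y → HigherDeriv (f x) (f y)
HigherDeriv-map f refl        = refl
HigherDeriv-map f (symm h)    = symm (HigherDeriv-map f h)
HigherDeriv-map f (trans h k) = trans (HigherDeriv-map f h) (HigherDeriv-map f k)

G0 : Set
G0 = Term

G1 : Set
G1 = Σ[ M ∈ Term ] Σ[ N ∈ Term ] RedSeq M N

G2 : Set
G2 = Σ[ M ∈ Term ] Σ[ N ∈ Term ] Σ[ p ∈ RedSeq M N ] Σ[ q ∈ RedSeq M N ]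
     Homotopy2 p q

G3 : Set
G3 = Σ[ M ∈ Term ] Σ[ N ∈ Term ] Σ[ p ∈ RedSeq M N ] Σ[ q ∈ RedSeq M N ]
     Σ[ α ∈ Homotopy2 p q ] Σ[ β ∈ Homotopy2 p q ] Homotopy3 α β

s1 t1 : G1 → G0
s1 (M , N , p) = M
t1 (M , N , p) = N

s2 t2 : G2 → G1
s2 (M , N , p , q , α) = (M , N , p)
t2 (M , N , p , q , α) = (M , N , q)

s3 t3 : G3 → G2
s3 (M , N , p , q , α , β , h) = (M , N , p , q , α)
t3 (M , N , p , q , α , β , h) = (M , N , p , q , β)

mutual
  Sig : ℕ → Set
  Sig 0 = G0
  Sig 1 = G1
  Sig 2 = G2
  Sig 3 = G3
  Sig (suc (suc (suc (suc n)))) =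
    Σ[ x ∈ Sig (suc (suc (suc n))) ] Σ[ y ∈ Sig (suc (suc (suc n))) ]
      ((srcSig {suc (suc n)} x ≡ srcSig {suc (suc n)} y
        × tgtSig {suc (suc n)} x ≡ tgtSig {suc (suc n)} y) × HigherDeriv x y)

  srcSig : {n : ℕ} → Sig (suc n) → Sig n
  srcSig {0} c = s1 c
  srcSig {1} c = s2 c
  srcSig {2} c = s3 c
  srcSig {suc (suc (suc n))} (x , y , _) = x

  tgtSig : {n : ℕ} → Sig (suc n) → Sig n
  tgtSig {0} c = t1 c
  tgtSig {1} c = t2 c
  tgtSig {2} c = t3 c
  tgtSig {suc (suc (suc n))} (x , y , _) = y

mutual
  Rc : ℕ → Set
  Rc 0 = G0
  Rc 1 = G1
  Rc 2 = G2
  Rc 3 = G3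
  Rc 4 = Σ[ x ∈ Rc 3 ] Σ[ y ∈ Rc 3 ]
           ((srcR {2} x ≡ srcR {2} y × tgtR {2} x ≡ tgtR {2} y) × HigherDeriv x y)
  Rc 5 = Σ[ x ∈ Rc 4 ] Σ[ y ∈ Rc 4 ]
           ((srcR {3} x ≡ srcR {3} y × tgtR {3} x ≡ tgtR {3} y) × HigherDeriv x y)
  Rc 6 = Σ[ x ∈ Rc 5 ] Σ[ y ∈ Rc 5 ]
           ((srcR {4} x ≡ srcR {4} y × tgtR {4} x ≡ tgtR {4} y) × HigherDeriv x y)
  Rc (suc (suc (suc (suc (suc (suc (suc n))))))) =
    Σ[ x ∈ Rc (suc (suc (suc (suc (suc (suc n)))))) ] Σ[ y ∈ Rc (suc (suc (suc (suc (suc (suc n)))))) ] HigherDeriv x y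

  srcR : {n : ℕ} → Rc (suc n) → Rc n
  srcR {0} c = s1 c
  srcR {1} c = s2 c
  srcR {2} c = s3 c
  srcR {3} (x , y , _) = x
  srcR {4} (x , y , _) = x
  srcR {5} (x , y , _) = x
  srcR {suc (suc (suc (suc (suc (suc n)))))} (x , y , _) = x

  tgtR : {n : ℕ} → Rc (suc n) → Rc n
  tgtR {0} c = t1 c
  tgtR {1} c = t2 c
  tgtR {2} c = t3 c
  tgtR {3} (x , y , _) = y
  tgtR {4} (x , y , _) = y
  tgtR {5} (x , y , _) = y
  tgtR {suc (suc (suc (suc (suc (suc n)))))} (x , y , _) = y

module Submission where

open import Defs
open import Data.Nat using (ℕ; suc)
open import Data.Product using (Σ; Σ-syntax; _×_; _,_)
open import Function using (_∘_)
open import Relation.Binary.PropositionalEquality using (_≡_; refl; sym; cong)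
import Relation.Binary.PropositionalEquality as ≡

-- In dimensions ≤ 6 the two towers coincide definitionally, so the realization is the
-- identity there. Above, a cell (x , y , h) is sent to the realized endpoints with the
-- transported derivation; the missing parallelism witness for Σ comes from the fact
-- that a higher derivation, being generated by refl, symm and trans alone, only ever
-- relates equal cells.

HigherDeriv⇒≡ : {X : Set} {x y : X} → HigherDeriv x y → x ≡ y
HigherDeriv⇒≡ refl        = refl
HigherDeriv⇒≡ (symm h)    = sym (HigherDeriv⇒≡ h)
HigherDeriv⇒≡ (trans h k) = ≡.trans (HigherDeriv⇒≡ h) (HigherDeriv⇒≡ k)

derivationCell : {m : ℕ} {X : Set} (f : X → Sig (suc (suc (suc m)))) {x y : X} →
                 HigherDeriv x y → Sig (suc (suc (suc (suc m))))
derivationCell f {x} {y} h =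
  f x , f y , (cong (srcSig ∘ f) x≡y , cong (tgtSig ∘ f) x≡y) , HigherDeriv-map f h
  where x≡y = HigherDeriv⇒≡ h

realize : (n : ℕ) → Rc n → Sig n
realize 0 x = x
realize 1 x = x
realize 2 x = x
realize 3 x = x
realize 4 x = x
realize 5 x = x
realize 6 x = x
realize (suc (suc (suc (suc (suc (suc (suc n))))))) (x , y , h) =
  derivationCell {suc (suc (suc n))} (realize (suc (suc (suc (suc (suc (suc n))))))) h

realize-boundary : (n : ℕ) (x : Rc (suc n)) →
                   (srcSig (realize (suc n) x) ≡ realize n (srcR x))
                   × (tgtSig (realize (suc n) x) ≡ realize n (tgtR x))
realize-boundary 0 x = refl , refl
realize-boundary 1 x = refl , refl
realize-boundary 2 x = refl , refl
realize-boundary 3 x = refl , refl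
realize-boundary 4 x = refl , refl
realize-boundary 5 x = refl , refl
realize-boundary (suc (suc (suc (suc (suc (suc n)))))) x = refl , refl

theoremA :
    Σ[ realize ∈ ((n : ℕ) → Rc n → Sig n) ]
      (((n : ℕ) (x : Rc (suc n)) →
          (srcSig (realize (suc n) x) ≡ realize n (srcR x))
          × (tgtSig (realize (suc n) x) ≡ realize n (tgtR x)))
      × (((x : Rc 0) → realize 0 x ≡ x)
        × ((x : Rc 1) → realize 1 x ≡ x)
        × ((x : Rc 2) → realize 2 x ≡ x)
        × ((x : Rc 3) → realize 3 x ≡ x)))
theoremA = realize , realize-boundary , (λ _ → refl) , (λ _ → refl) , (λ _ → refl) , (λ _ → refl)
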